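{- Let $T$ be a tree of order $n\geq 3$. Then \[ \gamma_{ct}(T) \leq n - \beta_1(T) - 1 = \alpha_1(T) - 1. \]
   Context: Two distinct edges are adjacent if they share a vertex. For a graph $G=(V,E)$, a set $F\subseteq E$ is an edge dominating set if every edge not in $F$ is adjacent to some edge of $F$. An edge dominating set $F$ is an edge cut dominating set if the spanning subgraph $(V,E\setminus F)$ is disconnected. The edge cut domination number $\gamma_{ct}(G)$ is the minimum cardinality of an edge cut dominating set of $G$. The matching number $\beta_1(G)$ is the maximum cardinality of a set of pairwise non-adjacent edges, and the edge covering number $\alpha_1(G)$ is the minimum cardinality of a set of edges such that every vertex is incident with at least one edge of the set. -}

module Defs where

open import Data.Nat using (ℕ; _≤_; _∸_)
open import Data.Fin using (Fin)
open import Data.Fin.Subset using (Subset; _∈_; _∉_; ∣_∣)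
open import Data.Product using (_×_; _,_; proj₁; proj₂; ∃; ∃-syntax; Σ)
open import Data.Sum using (_⊎_)
open import Data.List using (List; []; _∷_; length)
open import Data.List.Relation.Unary.Unique.Propositional using (Unique)
open import Relation.Binary.PropositionalEquality using (_≡_; _≢_)
open import Relation.Nullary using (¬_)

record Graph (n : ℕ) : Set where
  field
    m        : ℕ
    ends     : Fin m → Fin n × Fin n
    loopless : ∀ e → proj₁ (ends e) ≢ proj₂ (ends e)
    simple   : ∀ e f → (ends e ≡ ends f ⊎ ends e ≡ (proj₂ (ends f) , proj₁ (ends f))) → e ≡ f
open Graph public

module _ {n : ℕ} (G : Graph n) where

  Incident : Fin n → Fin (m G) → Set
  Incident v e = v ≡ proj₁ (ends G e) ⊎ v ≡ proj₂ (ends G e)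

  Joins : Fin (m G) → Fin n → Fin n → Set
  Joins e u v = ends G e ≡ (u , v) ⊎ ends G e ≡ (v , u)

  Adj : Fin n → Fin n → Set
  Adj u v = ∃[ e ] Joins e u v

  AdjEdges : Fin (m G) → Fin (m G) → Set
  AdjEdges e f = e ≢ f × ∃[ v ] (Incident v e × Incident v f)

  -- reachability in the spanning subgraph (V , S), S a set of edges
  data Reach (S : Subset (m G)) (u : Fin n) : Fin n → Set where
    here : Reach S u u
    step : ∀ {w v} e → Reach S u w → e ∈ S → Joins e w v → Reach S u v

  ConnectedSub : Subset (m G) → Set
  ConnectedSub S = ∀ u v → Reach S u v

  allEdges : Subset (m G)
  allEdges = Data.Fin.Subset.⊤

  Connected : Set
  Connected = ConnectedSub allEdges

  -- consecutive vertices of a list (closing back to the first vertex) are adjacent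
  PathAdj : Fin n → List (Fin n) → Set
  PathAdj first []           = Data.Unit.⊤ where import Data.Unit
  PathAdj first (x ∷ [])     = Adj x first
  PathAdj first (x ∷ y ∷ xs) = Adj x y × PathAdj first (y ∷ xs)

  IsCycle : List (Fin n) → Set
  IsCycle []       = Data.Empty.⊥ where import Data.Empty
  IsCycle (x ∷ xs) = 3 ≤ length (x ∷ xs) × Unique (x ∷ xs) × PathAdj x (x ∷ xs)

  Acyclic : Set
  Acyclic = ∀ vs → ¬ IsCycle vs

  IsTree : Set
  IsTree = Connected × Acyclic

  EdgeDominating : Subset (m G) → Set
  EdgeDominating F = ∀ e → e ∉ F → ∃[ f ] (f ∈ F × AdjEdges e f)

  EdgeCutDominating : Subset (m G) → Set
  EdgeCutDominating F = EdgeDominating F × ¬ ConnectedSub (Data.Fin.Subset.∁ F)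

  IsEdgeCutDomNumber : ℕ → Set
  IsEdgeCutDomNumber g =
    (∃[ F ] (EdgeCutDominating F × ∣ F ∣ ≡ g)) × (∀ F → EdgeCutDominating F → g ≤ ∣ F ∣)

  IsMatching : Subset (m G) → Set
  IsMatching M = ∀ e f → e ∈ M → f ∈ M → ¬ AdjEdges e f

  IsMatchingNumber : ℕ → Set
  IsMatchingNumber b =
    (∃[ M ] (IsMatching M × ∣ M ∣ ≡ b)) × (∀ M → IsMatching M → ∣ M ∣ ≤ b)

  IsEdgeCover : Subset (m G) → Set
  IsEdgeCover C = ∀ v → ∃[ e ] (e ∈ C × Incident v e)

  IsEdgeCoverNumber : ℕ → Set
  IsEdgeCoverNumber a =
    (∃[ C ] (IsEdgeCover C × ∣ C ∣ ≡ a)) × (∀ C → IsEdgeCover C → a ≤ ∣ C ∣)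

-- Gallai's identity α₁ + β₁ = n, valid in any graph without isolated vertices, gives the
-- equality. For the bound, note that deleting any edge of a tree disconnects it, so in a tree
-- the edge cut dominating sets are exactly the nonempty edge dominating sets. Fix a maximum
-- matching M; it is edge dominating. If M misses a vertex, then 2β₁ < n and M itself has size
-- at most n − β₁ − 1. If M is perfect, take an edge xz outside M and the edges xy, zw of M:
-- the set (M − xy − zw) ∪ {xz} of size β₁ − 1 = n − β₁ − 1 is still edge dominating, because
-- an edge it misses would have to join y and w, closing the cycle x y w z.
module Submission where

open import Defs
open import Data.Nat using (ℕ; suc; _≤_; _<_; _∸_; _+_; z≤n; s≤s; _<?_)
open import Data.Nat.Properties hiding (_≟_; suc-injective)
open import Data.Nat.Induction using (<-wellFounded)
open import Data.Fin using (Fin; zero; suc; fromℕ<; punchIn; punchOut)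
open import Data.Fin.Properties
  using (_≟_; suc-injective; any?; all?; punchInᵢ≢i; punchIn-injective; punchIn-punchOut)
open import Data.Fin.Subset
  using (Subset; _∈_; _∉_; ∣_∣; ⁅_⁆; _∪_; _-_; ∁; Nonempty; _⊆_; inside; outside)
  renaming (⊥ to ∅)
open import Data.Fin.Subset.Properties
  using (_∈?_; _⊆?_; anySubset?; nonempty?; ∉⊥; ∣⊥∣≡0; ∣p∣≤n; ∣∁p∣≡n∸∣p∣; ∣⁅x⁆∣≡1;
         x∈⁅x⁆; x∈⁅y⁆⇒x≡y; x∈p∪q⁺; x∈p∪q⁻; x∈p∧x≢y⇒x∈p-y; x∈p⇒∣p-x∣<∣p∣;
         x∉p⇒x∈∁p; x∈∁p⇒x∉p; p⊂q⇒∣p∣<∣q∣; p⊆q⇒∣p∣≤∣q∣)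
open import Data.Vec.Base using ([]; _∷_; here; there)
open import Data.List using (List; []; _∷_)
open import Data.List.Relation.Unary.Any using (here; there)
open import Data.List.Relation.Unary.All using ([]; _∷_)
open import Data.List.Relation.Unary.All.Properties using (¬Any⇒All¬)
open import Data.List.Relation.Unary.AllPairs using ([]; _∷_)
open import Data.List.Relation.Unary.Unique.Propositional using (Unique)
import Data.List.Membership.Propositional as List
open import Data.Product using (_×_; _,_; proj₁; proj₂; ∃; ∃-syntax; swap)
open import Data.Sum using (_⊎_; inj₁; inj₂; [_,_])
open import Data.Empty using (⊥-elim)
open import Function using (_∘_)
open import Induction.WellFounded using (Acc; acc)
open import Relation.Nullary using (¬_; Dec; yes; no)
open import Relation.Nullary.Decidable using (_×-dec_; _⊎-dec_; _→-dec_; ¬?)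
open import Relation.Unary using (Pred; Decidable)
open import Relation.Binary.PropositionalEquality
  using (_≡_; _≢_; refl; sym; trans; cong; cong₂; subst; module ≡-Reasoning)

∣p∪q∣≤∣p∣+∣q∣ : ∀ {n} (p q : Subset n) → ∣ p ∪ q ∣ ≤ ∣ p ∣ + ∣ q ∣
∣p∪q∣≤∣p∣+∣q∣ []            []            = z≤n
∣p∪q∣≤∣p∣+∣q∣ (outside ∷ p) (outside ∷ q) = ∣p∪q∣≤∣p∣+∣q∣ p q
∣p∪q∣≤∣p∣+∣q∣ (outside ∷ p) (inside ∷ q)  =
  subst (suc ∣ p ∪ q ∣ ≤_) (sym (+-suc (∣ p ∣) (∣ q ∣))) (s≤s (∣p∪q∣≤∣p∣+∣q∣ p q))
∣p∪q∣≤∣p∣+∣q∣ (inside ∷ p)  (outside ∷ q) = s≤s (∣p∪q∣≤∣p∣+∣q∣ p q)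
∣p∪q∣≤∣p∣+∣q∣ (inside ∷ p)  (inside ∷ q)  =
  s≤s (≤-trans (∣p∪q∣≤∣p∣+∣q∣ p q) (+-monoʳ-≤ ∣ p ∣ (n≤1+n ∣ q ∣)))

∣p∪q∣≡∣p∣+∣q∣ : ∀ {n} (p q : Subset n) → (∀ {x} → x ∈ p → x ∉ q) → ∣ p ∪ q ∣ ≡ ∣ p ∣ + ∣ q ∣
∣p∪q∣≡∣p∣+∣q∣ []            []            _        = refl
∣p∪q∣≡∣p∣+∣q∣ (outside ∷ p) (outside ∷ q) disjoint =
  ∣p∪q∣≡∣p∣+∣q∣ p q (λ x∈p → disjoint (there x∈p) ∘ there)
∣p∪q∣≡∣p∣+∣q∣ (outside ∷ p) (inside ∷ q)  disjoint =
  trans (cong suc (∣p∪q∣≡∣p∣+∣q∣ p q (λ x∈p → disjoint (there x∈p) ∘ there)))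
        (sym (+-suc (∣ p ∣) (∣ q ∣)))
∣p∪q∣≡∣p∣+∣q∣ (inside ∷ p)  (outside ∷ q) disjoint =
  cong suc (∣p∪q∣≡∣p∣+∣q∣ p q (λ x∈p → disjoint (there x∈p) ∘ there))
∣p∪q∣≡∣p∣+∣q∣ (inside ∷ p)  (inside ∷ q)  disjoint = ⊥-elim (disjoint here here)

∪-⊆ : ∀ {n} {p q r : Subset n} → p ⊆ r → q ⊆ r → p ∪ q ⊆ r
∪-⊆ {p = p} {q} p⊆r q⊆r x∈p∪q with x∈p∪q⁻ p q x∈p∪q
... | inj₁ x∈p = p⊆r x∈p
... | inj₂ x∈q = q⊆r x∈q

x∈p⇒⁅x⁆⊆p : ∀ {n} {x : Fin n} {p} → x ∈ p → ⁅ x ⁆ ⊆ p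
x∈p⇒⁅x⁆⊆p {x = x} {p} x∈p y∈⁅x⁆ = subst (_∈ p) (sym (x∈⁅y⁆⇒x≡y x y∈⁅x⁆)) x∈p

image : ∀ {k n} → (Fin k → Fin n) → Subset k → Subset n
image f []            = ∅
image f (outside ∷ p) = image (f ∘ suc) p
image f (inside ∷ p)  = ⁅ f zero ⁆ ∪ image (f ∘ suc) p

∈-image⁺ : ∀ {k n} (f : Fin k → Fin n) {p x} → x ∈ p → f x ∈ image f p
∈-image⁺ f {outside ∷ p} (there x∈p) = ∈-image⁺ (f ∘ suc) x∈p
∈-image⁺ f {inside ∷ p}  here        = x∈p∪q⁺ (inj₁ (x∈⁅x⁆ (f zero)))
∈-image⁺ f {inside ∷ p}  (there x∈p) = x∈p∪q⁺ (inj₂ (∈-image⁺ (f ∘ suc) x∈p))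

∈-image⁻ : ∀ {k n} (f : Fin k → Fin n) {p y} → y ∈ image f p → ∃[ x ] (x ∈ p × f x ≡ y)
∈-image⁻ f {[]}          y∈ = ⊥-elim (∉⊥ y∈)
∈-image⁻ f {outside ∷ p} y∈ with ∈-image⁻ (f ∘ suc) y∈
... | x , x∈p , fx≡y = suc x , there x∈p , fx≡y
∈-image⁻ f {inside ∷ p}  y∈ with x∈p∪q⁻ ⁅ f zero ⁆ (image (f ∘ suc) p) y∈
... | inj₁ y∈⁅f0⁆ = zero , here , sym (x∈⁅y⁆⇒x≡y _ y∈⁅f0⁆)
... | inj₂ y∈img with ∈-image⁻ (f ∘ suc) y∈img
...   | x , x∈p , fx≡y = suc x , there x∈p , fx≡y

∣image∣≤∣p∣ : ∀ {k n} (f : Fin k → Fin n) p → ∣ image f p ∣ ≤ ∣ p ∣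
∣image∣≤∣p∣ {n = n} f [] = ≤-reflexive (∣⊥∣≡0 n)
∣image∣≤∣p∣ f (outside ∷ p) = ∣image∣≤∣p∣ (f ∘ suc) p
∣image∣≤∣p∣ f (inside ∷ p)  = begin
  ∣ ⁅ f zero ⁆ ∪ image (f ∘ suc) p ∣      ≤⟨ ∣p∪q∣≤∣p∣+∣q∣ ⁅ f zero ⁆ _ ⟩
  ∣ ⁅ f zero ⁆ ∣ + ∣ image (f ∘ suc) p ∣  ≡⟨ cong (_+ ∣ image (f ∘ suc) p ∣) (∣⁅x⁆∣≡1 (f zero)) ⟩
  suc ∣ image (f ∘ suc) p ∣                ≤⟨ s≤s (∣image∣≤∣p∣ (f ∘ suc) p) ⟩
  suc ∣ p ∣                                ∎
  where open ≤-Reasoning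

∣image∣≡∣p∣ : ∀ {k n} (f : Fin k → Fin n) p →
  (∀ {x y} → x ∈ p → y ∈ p → f x ≡ f y → x ≡ y) → ∣ image f p ∣ ≡ ∣ p ∣
∣image∣≡∣p∣ {n = n} f []  _ = ∣⊥∣≡0 n
∣image∣≡∣p∣ f (outside ∷ p) injective =
  ∣image∣≡∣p∣ (f ∘ suc) p (λ x∈p y∈p eq → suc-injective (injective (there x∈p) (there y∈p) eq))
∣image∣≡∣p∣ f (inside ∷ p) injective = begin
  ∣ ⁅ f zero ⁆ ∪ image (f ∘ suc) p ∣      ≡⟨ ∣p∪q∣≡∣p∣+∣q∣ ⁅ f zero ⁆ _ f0∉image ⟩
  ∣ ⁅ f zero ⁆ ∣ + ∣ image (f ∘ suc) p ∣
    ≡⟨ cong₂ _+_ (∣⁅x⁆∣≡1 (f zero)) (∣image∣≡∣p∣ (f ∘ suc) p injective′) ⟩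
  suc ∣ p ∣                                ∎
  where
  open ≡-Reasoning
  injective′ : ∀ {x y} → x ∈ p → y ∈ p → f (suc x) ≡ f (suc y) → x ≡ y
  injective′ x∈p y∈p eq = suc-injective (injective (there x∈p) (there y∈p) eq)
  f0∉image : ∀ {y} → y ∈ ⁅ f zero ⁆ → y ∉ image (f ∘ suc) p
  f0∉image y∈⁅f0⁆ y∈image with ∈-image⁻ (f ∘ suc) y∈image
  ... | x , x∈p , fx≡y with injective (there x∈p) here (trans fx≡y (x∈⁅y⁆⇒x≡y _ y∈⁅f0⁆))
  ... | ()

module _ {n ℓ} {P : Pred (Subset n) ℓ} (P? : Decidable P) (μ : Subset n → ℕ) where

  argmin : ∀ {S} → P S → ∃[ F ] (P F × (∀ F′ → P F′ → μ F ≤ μ F′))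
  argmin {S} PS = go S (<-wellFounded (μ S)) PS
    where
    go : ∀ S → Acc _<_ (μ S) → P S → ∃[ F ] (P F × (∀ F′ → P F′ → μ F ≤ μ F′))
    go S (acc smaller) PS with anySubset? (λ F → P? F ×-dec (μ F <? μ S))
    ... | yes (F , PF , μF<μS) = go F (smaller μF<μS) PF
    ... | no ¬better = S , PS , λ F PF → ≮⇒≥ (λ μF<μS → ¬better (F , PF , μF<μS))

m+n<o⇒m≤o∸n∸1 : ∀ m n o → m + n < o → m ≤ o ∸ n ∸ 1
m+n<o⇒m≤o∸n∸1 m n o m+n<o = subst (m ≤_) o∸[1+n]≡o∸n∸1 (m+n≤o⇒m≤o∸n m m+[1+n]≤o)
  where
  m+[1+n]≤o : m + suc n ≤ o
  m+[1+n]≤o = subst (_≤ o) (sym (+-suc m n)) m+n<o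
  o∸[1+n]≡o∸n∸1 : o ∸ suc n ≡ o ∸ n ∸ 1
  o∸[1+n]≡o∸n∸1 = sym (trans (∸-+-assoc o n 1) (cong (o ∸_) (+-comm n 1)))

distinct-from-two : ∀ {n} → 3 ≤ n → (x y : Fin n) → ∃[ z ] (z ≢ x × z ≢ y)
distinct-from-two (s≤s (s≤s (s≤s _))) x y with x ≟ y
... | yes refl = punchIn x zero , punchInᵢ≢i x zero , punchInᵢ≢i x zero
... | no x≢y   = punchIn x (punchIn j zero) , punchInᵢ≢i x _ , z≢y
  where
  j : Fin _
  j = punchOut x≢y
  z≢y : punchIn x (punchIn j zero) ≢ y
  z≢y eq = punchInᵢ≢i j zero (punchIn-injective x _ _ (trans eq (sym (punchIn-punchOut x≢y))))

module _ {n : ℕ} (G : Graph n) where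

  private
    Edge : Set
    Edge = Fin (m G)
    open import Data.List.Membership.DecPropositional (_≟_ {n}) using () renaming (_∈?_ to _∈ₗ?_)

  Joins-sym : ∀ {e u v} → Joins G e u v → Joins G e v u
  Joins-sym (inj₁ eq) = inj₂ eq
  Joins-sym (inj₂ eq) = inj₁ eq

  Joins⇒≢ : ∀ {e u v} → Joins G e u v → u ≢ v
  Joins⇒≢ {e} (inj₁ refl) u≡v = loopless G e u≡v
  Joins⇒≢ {e} (inj₂ refl) u≡v = loopless G e (sym u≡v)

  Joins-unique : ∀ {e f u v} → Joins G e u v → Joins G f u v → e ≡ f
  Joins-unique {e} {f} (inj₁ e≡) (inj₁ f≡) = simple G e f (inj₁ (trans e≡ (sym f≡)))
  Joins-unique {e} {f} (inj₁ e≡) (inj₂ f≡) = simple G e f (inj₂ (trans e≡ (cong swap (sym f≡))))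
  Joins-unique {e} {f} (inj₂ e≡) (inj₁ f≡) = simple G e f (inj₂ (trans e≡ (cong swap (sym f≡))))
  Joins-unique {e} {f} (inj₂ e≡) (inj₂ f≡) = simple G e f (inj₁ (trans e≡ (sym f≡)))

  Joins⇒Incidentˡ : ∀ {e u v} → Joins G e u v → Incident G u e
  Joins⇒Incidentˡ (inj₁ refl) = inj₁ refl
  Joins⇒Incidentˡ (inj₂ refl) = inj₂ refl

  Joins⇒Incidentʳ : ∀ {e u v} → Joins G e u v → Incident G v e
  Joins⇒Incidentʳ = Joins⇒Incidentˡ ∘ Joins-sym

  Incident⇒Joins : ∀ {e u} → Incident G u e → ∃[ v ] Joins G e u v
  Incident⇒Joins (inj₁ refl) = _ , inj₁ refl
  Incident⇒Joins (inj₂ refl) = _ , inj₂ refl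

  Joins-Incident : ∀ {e u v p} → Joins G e u v → Incident G p e → p ≡ u ⊎ p ≡ v
  Joins-Incident (inj₁ refl) p-e = p-e
  Joins-Incident (inj₂ refl) (inj₁ p≡) = inj₂ p≡
  Joins-Incident (inj₂ refl) (inj₂ p≡) = inj₁ p≡

  Incident? : ∀ v e → Dec (Incident G v e)
  Incident? v e = (v ≟ proj₁ (ends G e)) ⊎-dec (v ≟ proj₂ (ends G e))

  AdjEdges? : ∀ e f → Dec (AdjEdges G e f)
  AdjEdges? e f = ¬? (e ≟ f) ×-dec any? (λ v → Incident? v e ×-dec Incident? v f)

  IsMatching? : ∀ M → Dec (IsMatching G M)
  IsMatching? M = all? λ e → all? λ f → (e ∈? M) →-dec ((f ∈? M) →-dec ¬? (AdjEdges? e f))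

  EdgeDominating? : ∀ F → Dec (EdgeDominating G F)
  EdgeDominating? F = all? λ e → ¬? (e ∈? F) →-dec any? (λ f → (f ∈? F) ×-dec AdjEdges? e f)

  EdgeDominating⇒Nonempty : ∀ {F} → Edge → EdgeDominating G F → Nonempty F
  EdgeDominating⇒Nonempty {F} e dominating with e ∈? F
  ... | yes e∈F = e , e∈F
  ... | no  e∉F = let f , f∈F , _ = dominating e e∉F in f , f∈F

  Reach-mono : ∀ {S S′ u v} → S ⊆ S′ → Reach G S u v → Reach G S′ u v
  Reach-mono S⊆S′ here             = here
  Reach-mono S⊆S′ (step e r e∈S j) = step e (Reach-mono S⊆S′ r) (S⊆S′ e∈S) j

  Reach⇒first-edge : ∀ {S u v} → Reach G S u v → u ≢ v → ∃[ e ] (e ∈ S × Incident G u e)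
  Reach⇒first-edge here u≢u = ⊥-elim (u≢u refl)
  Reach⇒first-edge {u = u} (step {w} e r e∈S j) u≢v with u ≟ w
  ... | yes refl = e , e∈S , Joins⇒Incidentˡ j
  ... | no  u≢w  = Reach⇒first-edge r u≢w

  Reach⇒crossing-edge : ∀ {ℓ S u v} {A : Pred (Fin n) ℓ} → Decidable A → A u → ¬ A v → Reach G S u v →
    ∃[ e ] ∃[ a ] ∃[ b ] (e ∈ S × Joins G e a b × A a × ¬ A b)
  Reach⇒crossing-edge A? Au ¬Av here = ⊥-elim (¬Av Au)
  Reach⇒crossing-edge A? Au ¬Av (step {w} {v} e r e∈S j) with A? w
  ... | yes Aw = e , w , v , e∈S , j , Aw , ¬Av
  ... | no ¬Aw = Reach⇒crossing-edge A? Au ¬Aw r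

  data PathTo (S : Subset (m G)) (u : Fin n) : List (Fin n) → Set where
    end  : PathTo S u (u ∷ [])
    edge : ∀ {x y xs} e → e ∈ S → Joins G e x y → PathTo S u (y ∷ xs) → PathTo S u (x ∷ y ∷ xs)

  PathTo-suffix : ∀ {S u v x xs} → PathTo S u (x ∷ xs) → Unique (x ∷ xs) → v List.∈ x ∷ xs →
    ∃[ ys ] (PathTo S u (v ∷ ys) × Unique (v ∷ ys))
  PathTo-suffix p             unique       (here refl) = _ , p , unique
  PathTo-suffix (edge _ _ _ p) (_ ∷ unique) (there v∈) = PathTo-suffix p unique v∈

  Reach⇒PathTo : ∀ {S u v} → Reach G S u v → ∃[ ys ] (PathTo S u (v ∷ ys) × Unique (v ∷ ys))
  Reach⇒PathTo here = [] , end , [] ∷ []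
  Reach⇒PathTo (step {w} {v} e r e∈S j) with Reach⇒PathTo r
  ... | ys , p , unique with v ∈ₗ? w ∷ ys
  ...   | yes v∈ = PathTo-suffix p unique v∈
  ...   | no  v∉ = w ∷ ys , edge e e∈S (Joins-sym j) p , ¬Any⇒All¬ (w ∷ ys) v∉ ∷ unique

  PathTo⇒PathAdj : ∀ {S u v x xs} → PathTo S u (x ∷ xs) → Adj G u v → PathAdj G v (x ∷ xs)
  PathTo⇒PathAdj end                 u-v = u-v
  PathTo⇒PathAdj (edge e _ j p) u-v = (e , j) , PathTo⇒PathAdj p u-v

  Acyclic⇒¬Reach∁ : Acyclic G → ∀ {F e u v} → e ∈ F → Joins G e u v → ¬ Reach G (∁ F) u v
  Acyclic⇒¬Reach∁ acyclic {F} {e} {u} {v} e∈F j r with Reach⇒PathTo r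
  ... | []             , end                  , _      = Joins⇒≢ j refl
  ... | (_ ∷ [])       , edge e′ e′∈∁F j′ end , _      =
    x∈∁p⇒x∉p (subst (_∈ ∁ F) (Joins-unique j′ (Joins-sym j)) e′∈∁F) e∈F
  ... | (y ∷ z ∷ zs)   , p                    , unique =
    acyclic (v ∷ y ∷ z ∷ zs) (s≤s (s≤s (s≤s z≤n)) , unique , PathTo⇒PathAdj p (e , j))

  Acyclic⇒¬ConnectedSub∁ : Acyclic G → ∀ {F} → Nonempty F → ¬ ConnectedSub G (∁ F)
  Acyclic⇒¬ConnectedSub∁ acyclic (e , e∈F) connected =
    Acyclic⇒¬Reach∁ acyclic e∈F (inj₁ refl) (connected _ _)

  Connected⇒Nonempty : Connected G → ∀ {F} → ¬ ConnectedSub G (∁ F) → Nonempty F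
  Connected⇒Nonempty connected {F} disconnected with nonempty? F
  ... | yes ne = ne
  ... | no ¬ne = ⊥-elim (disconnected λ u v → Reach-mono all⊆∁F (connected u v))
    where
    all⊆∁F : allEdges G ⊆ ∁ F
    all⊆∁F {e} _ = x∉p⇒x∈∁p (λ e∈F → ¬ne (e , e∈F))

  NoIsolatedVertex : Set
  NoIsolatedVertex = ∀ v → ∃[ e ] Incident G v e

  covered : Subset (m G) → Subset n
  covered S = image (proj₁ ∘ ends G) S ∪ image (proj₂ ∘ ends G) S

  ∈-covered⁺ : ∀ {S v e} → e ∈ S → Incident G v e → v ∈ covered S
  ∈-covered⁺ e∈S (inj₁ refl) = x∈p∪q⁺ (inj₁ (∈-image⁺ _ e∈S))
  ∈-covered⁺ e∈S (inj₂ refl) = x∈p∪q⁺ (inj₂ (∈-image⁺ _ e∈S))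

  ∈-covered⁻ : ∀ {S v} → v ∈ covered S → ∃[ e ] (e ∈ S × Incident G v e)
  ∈-covered⁻ {S} v∈ with x∈p∪q⁻ (image (proj₁ ∘ ends G) S) _ v∈
  ... | inj₁ v∈₁ = let e , e∈S , eq = ∈-image⁻ _ v∈₁ in e , e∈S , inj₁ (sym eq)
  ... | inj₂ v∈₂ = let e , e∈S , eq = ∈-image⁻ _ v∈₂ in e , e∈S , inj₂ (sym eq)

  FreeEdge : Subset (m G) → Edge → Set
  FreeEdge M e = ∀ {v} → Incident G v e → v ∉ covered M

  IsMaximumMatching : Subset (m G) → Set
  IsMaximumMatching M = IsMatching G M × (∀ M′ → IsMatching G M′ → ∣ M′ ∣ ≤ ∣ M ∣)

  module _ {M} (matching : IsMatching G M) where

    matching-edge-unique : ∀ {e f v} → e ∈ M → f ∈ M → Incident G v e → Incident G v f → e ≡ f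
    matching-edge-unique {e} {f} {v} e∈M f∈M v-e v-f with e ≟ f
    ... | yes e≡f = e≡f
    ... | no  e≢f = ⊥-elim (matching e f e∈M f∈M (e≢f , v , v-e , v-f))

    ∣covered∣≡∣M∣+∣M∣ : ∣ covered M ∣ ≡ ∣ M ∣ + ∣ M ∣
    ∣covered∣≡∣M∣+∣M∣ = begin
      ∣ image (proj₁ ∘ ends G) M ∪ image (proj₂ ∘ ends G) M ∣      ≡⟨ ∣p∪q∣≡∣p∣+∣q∣ _ _ disjoint ⟩
      ∣ image (proj₁ ∘ ends G) M ∣ + ∣ image (proj₂ ∘ ends G) M ∣  ≡⟨ cong₂ _+_ injective₁ injective₂ ⟩
      ∣ M ∣ + ∣ M ∣                                                 ∎
      where
      open ≡-Reasoning
      injective₁ : ∣ image (proj₁ ∘ ends G) M ∣ ≡ ∣ M ∣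
      injective₁ = ∣image∣≡∣p∣ _ M λ e∈M f∈M eq → matching-edge-unique e∈M f∈M (inj₁ refl) (inj₁ eq)
      injective₂ : ∣ image (proj₂ ∘ ends G) M ∣ ≡ ∣ M ∣
      injective₂ = ∣image∣≡∣p∣ _ M λ e∈M f∈M eq → matching-edge-unique e∈M f∈M (inj₂ refl) (inj₂ eq)
      disjoint : ∀ {v} → v ∈ image (proj₁ ∘ ends G) M → v ∉ image (proj₂ ∘ ends G) M
      disjoint v∈₁ v∈₂ with ∈-image⁻ (proj₁ ∘ ends G) v∈₁ | ∈-image⁻ (proj₂ ∘ ends G) v∈₂
      ... | e , e∈M , refl | f , f∈M , eq
        with refl ← matching-edge-unique e∈M f∈M (inj₁ refl) (inj₂ (sym eq)) = loopless G e (sym eq)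

    ∣uncovered∣+∣M∣+∣M∣≡n : ∣ ∁ (covered M) ∣ + (∣ M ∣ + ∣ M ∣) ≡ n
    ∣uncovered∣+∣M∣+∣M∣≡n = begin
      ∣ ∁ (covered M) ∣ + (∣ M ∣ + ∣ M ∣)
        ≡⟨ cong₂ _+_ (∣∁p∣≡n∸∣p∣ (covered M)) (sym ∣covered∣≡∣M∣+∣M∣) ⟩
      n ∸ ∣ covered M ∣ + ∣ covered M ∣      ≡⟨ m∸n+n≡m (∣p∣≤n (covered M)) ⟩
      n                                       ∎
      where open ≡-Reasoning

    module _ {e} (free : FreeEdge M e) where

      IsMatching-∪-free : IsMatching G (M ∪ ⁅ e ⁆)
      IsMatching-∪-free f f′ f∈ f′∈ (f≢f′ , v , v-f , v-f′)
        with x∈p∪q⁻ M _ f∈ | x∈p∪q⁻ M _ f′∈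
      ... | inj₁ f∈M | inj₁ f′∈M = matching f f′ f∈M f′∈M (f≢f′ , v , v-f , v-f′)
      ... | inj₁ f∈M | inj₂ f′∈e =
        free (subst (Incident G v) (x∈⁅y⁆⇒x≡y e f′∈e) v-f′) (∈-covered⁺ f∈M v-f)
      ... | inj₂ f∈e | inj₁ f′∈M =
        free (subst (Incident G v) (x∈⁅y⁆⇒x≡y e f∈e) v-f) (∈-covered⁺ f′∈M v-f′)
      ... | inj₂ f∈e | inj₂ f′∈e = f≢f′ (trans (x∈⁅y⁆⇒x≡y e f∈e) (sym (x∈⁅y⁆⇒x≡y e f′∈e)))

      ∣M∣<∣M∪free∣ : ∣ M ∣ < ∣ M ∪ ⁅ e ⁆ ∣
      ∣M∣<∣M∪free∣ =
        p⊂q⇒∣p∣<∣q∣ ((λ f∈M → x∈p∪q⁺ {p = M} (inj₁ f∈M)) , e , x∈p∪q⁺ (inj₂ (x∈⁅x⁆ e)) , e∉M)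
        where
        e∉M : e ∉ M
        e∉M e∈M = free (inj₁ refl) (∈-covered⁺ e∈M (inj₁ refl))

  Incident-two-ends : ∀ {e v w p} → Incident G v e → Incident G w e → v ≢ w →
    Incident G p e → p ≡ v ⊎ p ≡ w
  Incident-two-ends v-e w-e v≢w p-e with Incident⇒Joins v-e
  ... | _ , j with Joins-Incident j w-e | Joins-Incident j p-e
  ...   | inj₁ w≡v  | _          = ⊥-elim (v≢w (sym w≡v))
  ...   | inj₂ _    | inj₁ p≡v   = inj₁ p≡v
  ...   | inj₂ w≡v′ | inj₂ p≡v′  = inj₂ (trans p≡v′ (sym w≡v′))

  IsMaximumMatching⇒EdgeDominating : ∀ {M} → IsMaximumMatching M → EdgeDominating G M
  IsMaximumMatching⇒EdgeDominating {M} (matching , maximum) e e∉M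
    with any? (λ f → (f ∈? M) ×-dec AdjEdges? e f)
  ... | yes dominated = dominated
  ... | no ¬dominated =
    ⊥-elim (<⇒≱ (∣M∣<∣M∪free∣ matching free) (maximum _ (IsMatching-∪-free matching free)))
    where
    free : FreeEdge M e
    free {v} v-e v∈ = let f , f∈M , v-f = ∈-covered⁻ v∈ in
      ¬dominated (f , f∈M , (λ e≡f → e∉M (subst (_∈ M) (sym e≡f) f∈M)) , v , v-e , v-f)

  matching⇒EdgeCover : NoIsolatedVertex → ∀ {M} → IsMatching G M →
    ∃[ C ] (IsEdgeCover G C × ∣ C ∣ ≤ ∣ M ∣ + ∣ ∁ (covered M) ∣)
  matching⇒EdgeCover noIsolated {M} _ = C , cover , size
    where
    chosen : Fin n → Edge
    chosen v = proj₁ (noIsolated v)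
    C : Subset (m G)
    C = M ∪ image chosen (∁ (covered M))
    cover : IsEdgeCover G C
    cover v with v ∈? covered M
    ... | yes v∈ = let e , e∈M , v-e = ∈-covered⁻ v∈ in e , x∈p∪q⁺ (inj₁ e∈M) , v-e
    ... | no  v∉ =
      chosen v , x∈p∪q⁺ (inj₂ (∈-image⁺ chosen (x∉p⇒x∈∁p v∉))) , proj₂ (noIsolated v)
    size : ∣ C ∣ ≤ ∣ M ∣ + ∣ ∁ (covered M) ∣
    size = ≤-trans (∣p∪q∣≤∣p∣+∣q∣ M _) (+-monoʳ-≤ (∣ M ∣) (∣image∣≤∣p∣ chosen (∁ (covered M))))

  ∅-IsMatching : IsMatching G ∅
  ∅-IsMatching _ _ e∈∅ = ⊥-elim (∉⊥ e∈∅)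

  ∃-maximal-matching-⊆ : ∀ C →
    ∃[ M ] (IsMatching G M × M ⊆ C × (∀ {e} → e ∈ C → ¬ FreeEdge M e))
  ∃-maximal-matching-⊆ C =
    let M , (matching , M⊆C) , minimal =
          argmin (λ M → IsMatching? M ×-dec (M ⊆? C)) (λ M → m G ∸ ∣ M ∣)
                 (∅-IsMatching , ⊥-elim ∘ ∉⊥)
    in M , matching , M⊆C , λ {e} e∈C free →
         <⇒≱ (∣M∣<∣M∪free∣ matching free)
             (∸-cancelʳ-≤ (∣p∣≤n (M ∪ ⁅ e ⁆))
               (minimal _ (IsMatching-∪-free matching free , ∪-⊆ M⊆C (x∈p⇒⁅x⁆⊆p e∈C))))

  -- Each vertex left uncovered by a maximal matching M ⊆ C picks its own edge of C, outside M.
  EdgeCover⇒matching : ∀ {C} → IsEdgeCover G C → ∃[ M ] (IsMatching G M × n ≤ ∣ C ∣ + ∣ M ∣)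
  EdgeCover⇒matching {C} cover with ∃-maximal-matching-⊆ C
  ... | M , matching , M⊆C , maximal = M , matching , (begin
    n                                  ≡⟨ sym (∣uncovered∣+∣M∣+∣M∣≡n matching) ⟩
    ∣ U ∣ + (∣ M ∣ + ∣ M ∣)             ≡⟨ sym (+-assoc (∣ U ∣) (∣ M ∣) (∣ M ∣)) ⟩
    ∣ U ∣ + ∣ M ∣ + ∣ M ∣
      ≡⟨ cong (λ k → k + ∣ M ∣ + ∣ M ∣) (sym (∣image∣≡∣p∣ chosen U chosen-injective)) ⟩
    ∣ image chosen U ∣ + ∣ M ∣ + ∣ M ∣
      ≡⟨ cong (_+ ∣ M ∣) (sym (∣p∪q∣≡∣p∣+∣q∣ (image chosen U) M chosen∉M)) ⟩
    ∣ image chosen U ∪ M ∣ + ∣ M ∣      ≤⟨ +-monoˡ-≤ (∣ M ∣) (p⊆q⇒∣p∣≤∣q∣ (∪-⊆ chosen⊆C M⊆C)) ⟩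
    ∣ C ∣ + ∣ M ∣                       ∎)
    where
    open ≤-Reasoning
    U : Subset n
    U = ∁ (covered M)
    chosen : Fin n → Edge
    chosen v = proj₁ (cover v)
    chosen-incident : ∀ v → Incident G v (chosen v)
    chosen-incident v = proj₂ (proj₂ (cover v))
    chosen⊆C : image chosen U ⊆ C
    chosen⊆C e∈ with ∈-image⁻ chosen {U} e∈
    ... | v , _ , refl = proj₁ (proj₂ (cover v))
    chosen∉M : ∀ {e} → e ∈ image chosen U → e ∉ M
    chosen∉M e∈ e∈M with ∈-image⁻ chosen e∈
    ... | v , v∈U , refl = x∈∁p⇒x∉p v∈U (∈-covered⁺ e∈M (chosen-incident v))
    chosen-injective : ∀ {u v} → u ∈ U → v ∈ U → chosen u ≡ chosen v → u ≡ v
    chosen-injective {u} {v} u∈U v∈U eq with u ≟ v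
    ... | yes u≡v = u≡v
    ... | no  u≢v = ⊥-elim (maximal (proj₁ (proj₂ (cover u))) free)
      where
      v-chosen-u : Incident G v (chosen u)
      v-chosen-u = subst (Incident G v) (sym eq) (chosen-incident v)
      free : FreeEdge M (chosen u)
      free p-e with Incident-two-ends (chosen-incident u) v-chosen-u u≢v p-e
      ... | inj₁ refl = x∈∁p⇒x∉p u∈U
      ... | inj₂ refl = x∈∁p⇒x∉p v∈U

  gallai : NoIsolatedVertex → ∀ {a b} → IsMatchingNumber G b → IsEdgeCoverNumber G a → a + b ≡ n
  gallai noIsolated ((M , matching , refl) , maximum) ((C , cover , refl) , minimum) =
    ≤-antisym a+b≤n n≤a+b
    where
    a+b≤n : ∣ C ∣ + ∣ M ∣ ≤ n
    a+b≤n = let C′ , cover′ , ∣C′∣≤ = matching⇒EdgeCover noIsolated matching in begin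
      ∣ C ∣ + ∣ M ∣                        ≤⟨ +-monoˡ-≤ (∣ M ∣) (≤-trans (minimum C′ cover′) ∣C′∣≤) ⟩
      ∣ M ∣ + ∣ ∁ (covered M) ∣ + ∣ M ∣    ≡⟨ cong (_+ ∣ M ∣) (+-comm (∣ M ∣) _) ⟩
      ∣ ∁ (covered M) ∣ + ∣ M ∣ + ∣ M ∣    ≡⟨ +-assoc _ (∣ M ∣) (∣ M ∣) ⟩
      ∣ ∁ (covered M) ∣ + (∣ M ∣ + ∣ M ∣)  ≡⟨ ∣uncovered∣+∣M∣+∣M∣≡n matching ⟩
      n                                    ∎
      where open ≤-Reasoning
    n≤a+b : n ≤ ∣ C ∣ + ∣ M ∣
    n≤a+b = let M′ , matching′ , n≤ = EdgeCover⇒matching cover in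
      ≤-trans n≤ (+-monoʳ-≤ ∣ C ∣ (maximum M′ matching′))

  Connected⇒edge-∉-matching : Connected G → ∀ {M} → IsMatching G M →
    ∀ e z → ¬ Incident G z e → ∃[ g ] g ∉ M
  Connected⇒edge-∉-matching connected {M} matching e z z∉e with e ∈? M
  ... | no  e∉M = e , e∉M
  ... | yes e∈M with Reach⇒crossing-edge (λ v → Incident? v e) (inj₁ refl) z∉e (connected _ z)
  ...   | g , a , b , _ , j , a-e , b∉e =
    g , λ g∈M → b∉e (subst (Incident G b) (matching-edge-unique matching g∈M e∈M (Joins⇒Incidentˡ j) a-e)
                             (Joins⇒Incidentʳ j))

  module PerfectMatchingSwap
    (acyclic : Acyclic G) {M} (matching : IsMatching G M) (perfect : ∀ v → v ∈ covered M)
    {g x z} (jg : Joins G g x z) (g∉M : g ∉ M)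
    {c₁ y} (c₁∈M : c₁ ∈ M) (j₁ : Joins G c₁ x y)
    {c₂ w} (c₂∈M : c₂ ∈ M) (j₂ : Joins G c₂ z w) where

    c₁≢c₂ : c₁ ≢ c₂
    c₁≢c₂ c₁≡c₂ with Joins-Incident j₁ (subst (Incident G z) (sym c₁≡c₂) (Joins⇒Incidentˡ j₂))
    ... | inj₁ z≡x = Joins⇒≢ jg (sym z≡x)
    ... | inj₂ z≡y = g∉M (subst (_∈ M) (Joins-unique j₁ (subst (Joins G g x) z≡y jg)) c₁∈M)

    x≢w : x ≢ w
    x≢w x≡w = c₁≢c₂ (matching-edge-unique matching c₁∈M c₂∈M (Joins⇒Incidentˡ j₁) x-c₂)
      where
      x-c₂ : Incident G x c₂
      x-c₂ = subst (λ v → Incident G v c₂) (sym x≡w) (Joins⇒Incidentʳ j₂)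

    y≢z : y ≢ z
    y≢z y≡z = c₁≢c₂ (matching-edge-unique matching c₁∈M c₂∈M (Joins⇒Incidentʳ j₁) y-c₂)
      where
      y-c₂ : Incident G y c₂
      y-c₂ = subst (λ v → Incident G v c₂) (sym y≡z) (Joins⇒Incidentˡ j₂)

    ¬Joins-y-w : ∀ {e} → ¬ Joins G e y w
    ¬Joins-y-w {e} j = acyclic (x ∷ y ∷ w ∷ z ∷ [])
      ( s≤s (s≤s (s≤s z≤n))
      , (Joins⇒≢ j₁ ∷ x≢w ∷ Joins⇒≢ jg ∷ []) ∷ (Joins⇒≢ j ∷ y≢z ∷ []) ∷ ((Joins⇒≢ j₂ ∘ sym) ∷ [])
        ∷ [] ∷ []
      , (c₁ , j₁) , (e , j) , (c₂ , Joins-sym j₂) , (g , Joins-sym jg))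

    F : Subset (m G)
    F = ⁅ g ⁆ ∪ (M - c₁ - c₂)

    g∈F : g ∈ F
    g∈F = x∈p∪q⁺ (inj₁ (x∈⁅x⁆ g))

    ∈F⁺ : ∀ {e} → e ∈ M → e ≢ c₁ → e ≢ c₂ → e ∈ F
    ∈F⁺ e∈M e≢c₁ e≢c₂ = x∈p∪q⁺ (inj₂ (x∈p∧x≢y⇒x∈p-y (x∈p∧x≢y⇒x∈p-y e∈M e≢c₁) e≢c₂))

    ∣F∣<∣M∣ : ∣ F ∣ < ∣ M ∣
    ∣F∣<∣M∣ = begin-strict
      ∣ ⁅ g ⁆ ∪ (M - c₁ - c₂) ∣          ≤⟨ ∣p∪q∣≤∣p∣+∣q∣ ⁅ g ⁆ _ ⟩
      ∣ ⁅ g ⁆ ∣ + ∣ M - c₁ - c₂ ∣        ≡⟨ cong (_+ ∣ M - c₁ - c₂ ∣) (∣⁅x⁆∣≡1 g) ⟩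
      suc ∣ M - c₁ - c₂ ∣                ≤⟨ x∈p⇒∣p-x∣<∣p∣ c₂∈M-c₁ ⟩
      ∣ M - c₁ ∣                          <⟨ x∈p⇒∣p-x∣<∣p∣ c₁∈M ⟩
      ∣ M ∣                               ∎
      where
      open ≤-Reasoning
      c₂∈M-c₁ : c₂ ∈ M - c₁
      c₂∈M-c₁ = x∈p∧x≢y⇒x∈p-y c₂∈M (c₁≢c₂ ∘ sym)

    Dominated : Edge → Set
    Dominated e = ∃[ f ] (f ∈ F × AdjEdges G e f)

    dominated-by-g : ∀ {e r} → e ≢ g → Incident G r e → r ≡ x ⊎ r ≡ z → Dominated e
    dominated-by-g e≢g r-e (inj₁ refl) = g , g∈F , e≢g , _ , r-e , Joins⇒Incidentˡ jg
    dominated-by-g e≢g r-e (inj₂ refl) = g , g∈F , e≢g , _ , r-e , Joins⇒Incidentʳ jg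

    endpoint-y-w : ∀ {e r} → e ∉ M → e ≢ g → Incident G r e → Dominated e ⊎ (r ≡ y ⊎ r ≡ w)
    endpoint-y-w {e} {r} e∉M e≢g r-e with ∈-covered⁻ (perfect r)
    ... | h , h∈M , r-h with h ≟ c₁ | h ≟ c₂
    ...   | no h≢c₁ | no h≢c₂ =
      inj₁ (h , ∈F⁺ h∈M h≢c₁ h≢c₂ , (λ e≡h → e∉M (subst (_∈ M) (sym e≡h) h∈M)) , r , r-e , r-h)
    ...   | yes refl | _ with Joins-Incident j₁ r-h
    ...     | inj₁ r≡x = inj₁ (dominated-by-g e≢g r-e (inj₁ r≡x))
    ...     | inj₂ r≡y = inj₂ (inj₁ r≡y)
    endpoint-y-w e∉M e≢g r-e | h , h∈M , r-h | no _ | yes refl with Joins-Incident j₂ r-h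
    ...     | inj₁ r≡z = inj₁ (dominated-by-g e≢g r-e (inj₂ r≡z))
    ...     | inj₂ r≡w = inj₂ (inj₂ r≡w)

    ∈M⇒≢g : ∀ {e} → e ∈ M → e ≢ g
    ∈M⇒≢g e∈M e≡g = g∉M (subst (_∈ M) e≡g e∈M)

    F-dominating : EdgeDominating G F
    F-dominating e e∉F with e ∈? M
    ... | yes e∈M with e ≟ c₁ | e ≟ c₂
    ...   | yes refl | _        = dominated-by-g (∈M⇒≢g e∈M) (Joins⇒Incidentˡ j₁) (inj₁ refl)
    ...   | no _     | yes refl = dominated-by-g (∈M⇒≢g e∈M) (Joins⇒Incidentˡ j₂) (inj₂ refl)
    ...   | no e≢c₁  | no e≢c₂  = ⊥-elim (e∉F (∈F⁺ e∈M e≢c₁ e≢c₂))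
    F-dominating e e∉F | no e∉M with e ≟ g
    ... | yes refl = ⊥-elim (e∉F g∈F)
    ... | no e≢g with endpoint-y-w e∉M e≢g (inj₁ refl) | endpoint-y-w e∉M e≢g (inj₂ refl)
    ...   | inj₁ dominated     | _                  = dominated
    ...   | inj₂ _             | inj₁ dominated     = dominated
    ...   | inj₂ (inj₁ e₁≡y)   | inj₂ (inj₁ e₂≡y)   = ⊥-elim (loopless G e (trans e₁≡y (sym e₂≡y)))
    ...   | inj₂ (inj₂ e₁≡w)   | inj₂ (inj₂ e₂≡w)   = ⊥-elim (loopless G e (trans e₁≡w (sym e₂≡w)))
    ...   | inj₂ (inj₁ e₁≡y)   | inj₂ (inj₂ e₂≡w)   = ⊥-elim (¬Joins-y-w (inj₁ (cong₂ _,_ e₁≡y e₂≡w)))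
    ...   | inj₂ (inj₂ e₁≡w)   | inj₂ (inj₁ e₂≡y)   = ⊥-elim (¬Joins-y-w (inj₂ (cong₂ _,_ e₁≡w e₂≡y)))

  perfectMatching⇒smaller-EdgeDominating : Acyclic G → ∀ {M} → IsMatching G M → (∀ v → v ∈ covered M) →
    ∀ {g} → g ∉ M → ∃[ F ] ((EdgeDominating G F × Nonempty F) × ∣ F ∣ < ∣ M ∣)
  perfectMatching⇒smaller-EdgeDominating acyclic {M} matching perfect {g} g∉M
    with ∈-covered⁻ (perfect (proj₁ (ends G g))) | ∈-covered⁻ (perfect (proj₂ (ends G g)))
  ... | c₁ , c₁∈M , x-c₁ | c₂ , c₂∈M , z-c₂ =
    let open PerfectMatchingSwap acyclic matching perfect (inj₁ refl) g∉M
                                 c₁∈M (proj₂ (Incident⇒Joins x-c₁)) c₂∈M (proj₂ (Incident⇒Joins z-c₂))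
    in F , (F-dominating , g , g∈F) , ∣F∣<∣M∣

  ∃-EdgeCutDomNumber≤ : Connected G → Acyclic G → ∀ {F} → EdgeDominating G F → Nonempty F →
    ∃[ γ ] (IsEdgeCutDomNumber G γ × γ ≤ ∣ F ∣)
  ∃-EdgeCutDomNumber≤ connected acyclic {F} dominating nonempty
    with argmin (λ F → EdgeDominating? F ×-dec nonempty? F) ∣_∣ (dominating , nonempty)
  ... | F₀ , (dominating₀ , nonempty₀) , minimal =
    ∣ F₀ ∣ , ((F₀ , (dominating₀ , Acyclic⇒¬ConnectedSub∁ acyclic nonempty₀) , refl) , least) ,
    minimal F (dominating , nonempty)
    where
    least : ∀ F′ → EdgeCutDominating G F′ → ∣ F₀ ∣ ≤ ∣ F′ ∣
    least F′ (dominating′ , disconnected′) =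
      minimal F′ (dominating′ , Connected⇒Nonempty connected disconnected′)

  module _ (3≤n : 3 ≤ n) (connected : Connected G) where

    Connected⇒NoIsolatedVertex : NoIsolatedVertex
    Connected⇒NoIsolatedVertex v =
      let u , u≢v , _ = distinct-from-two 3≤n v v
          e , _ , v-e = Reach⇒first-edge (connected v u) (u≢v ∘ sym)
      in e , v-e

    some-edge : Edge
    some-edge = proj₁ (Connected⇒NoIsolatedVertex (fromℕ< (≤-trans (s≤s z≤n) 3≤n)))

    ∃-edge-∉-matching : ∀ {M} → IsMatching G M → ∃[ g ] g ∉ M
    ∃-edge-∉-matching matching =
      let z , z≢x , z≢y = distinct-from-two 3≤n (proj₁ (ends G some-edge)) (proj₂ (ends G some-edge)) in
      Connected⇒edge-∉-matching connected matching some-edge z [ z≢x , z≢y ]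

    tree⇒small-EdgeDominating : Acyclic G → ∀ {M} → IsMaximumMatching M →
      ∃[ F ] ((EdgeDominating G F × Nonempty F) × ∣ F ∣ ≤ n ∸ ∣ M ∣ ∸ 1)
    tree⇒small-EdgeDominating acyclic {M} maximum@(matching , _)
      with any? (λ v → ¬? (v ∈? covered M))
    ... | yes (u , u∉) =
      M , (dominating , EdgeDominating⇒Nonempty some-edge dominating) , m+n<o⇒m≤o∸n∸1 _ _ _ (begin-strict
        ∣ M ∣ + ∣ M ∣                        <⟨ +-monoˡ-≤ (∣ M ∣ + ∣ M ∣) 0<∣U∣ ⟩
        ∣ ∁ (covered M) ∣ + (∣ M ∣ + ∣ M ∣)  ≡⟨ ∣uncovered∣+∣M∣+∣M∣≡n matching ⟩
        n                                    ∎)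
      where
      open ≤-Reasoning
      dominating : EdgeDominating G M
      dominating = IsMaximumMatching⇒EdgeDominating maximum
      0<∣U∣ : 0 < ∣ ∁ (covered M) ∣
      0<∣U∣ = ≤-trans (s≤s z≤n) (x∈p⇒∣p-x∣<∣p∣ (x∉p⇒x∈∁p u∉))
    ... | no ¬uncovered =
      let g , g∉M = ∃-edge-∉-matching matching
          F , dominating , ∣F∣<∣M∣ = perfectMatching⇒smaller-EdgeDominating acyclic matching perfect g∉M
      in F , dominating , m+n<o⇒m≤o∸n∸1 _ _ _ (begin-strict
        ∣ F ∣ + ∣ M ∣                        <⟨ +-monoˡ-< (∣ M ∣) ∣F∣<∣M∣ ⟩
        ∣ M ∣ + ∣ M ∣                        ≤⟨ m≤n+m (∣ M ∣ + ∣ M ∣) (∣ ∁ (covered M) ∣) ⟩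
        ∣ ∁ (covered M) ∣ + (∣ M ∣ + ∣ M ∣)  ≡⟨ ∣uncovered∣+∣M∣+∣M∣≡n matching ⟩
        n                                    ∎)
      where
      open ≤-Reasoning
      perfect : ∀ v → v ∈ covered M
      perfect v with v ∈? covered M
      ... | yes v∈ = v∈
      ... | no  v∉ = ⊥-elim (¬uncovered (v , v∉))

mainTheorem2 : (n : ℕ) → 3 ≤ n → (T : Graph n) → IsTree T →
    (b a : ℕ) → IsMatchingNumber T b → IsEdgeCoverNumber T a →
      (∃[ g ] (IsEdgeCutDomNumber T g × g ≤ n ∸ b ∸ 1)) × (n ∸ b ∸ 1 ≡ a ∸ 1)
mainTheorem2 n 3≤n T (connected , acyclic) b a β@((M , matching , refl) , maximum) α =
  let F , (dominating , nonempty) , ∣F∣≤n∸b∸1 =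
        tree⇒small-EdgeDominating T 3≤n connected acyclic (matching , maximum)
      γ , isγ , γ≤∣F∣ = ∃-EdgeCutDomNumber≤ T connected acyclic dominating nonempty
      a+b≡n = gallai T (Connected⇒NoIsolatedVertex T 3≤n connected) β α
  in (γ , isγ , ≤-trans γ≤∣F∣ ∣F∣≤n∸b∸1) ,
     cong (_∸ 1) (trans (cong (_∸ b) (sym a+b≡n)) (m+n∸n≡m a b))
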